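{- There are $2^{\aleph_0}$ (continuum many) hereditary classes which are minimal within the class of finite indecomposable loopless directed graphs; likewise there are $2^{\aleph_0}$ hereditary classes which are minimal within the class of finite indecomposable undirected graphs with loops.
   Context: A directed graph is a set $V$ with a binary relation $\rho$; loopless means $(x,x)\notin\rho$ for all $x$. An undirected graph with loops is a set with a symmetric binary relation (loops allowed). $A\subseteq V$ is an interval if for all $a,a'\in A$ and $x\notin A$: $x\rho a\Leftrightarrow x\rho a'$ and $a\rho x\Leftrightarrow a'\rho x$; the graph is indecomposable if its only intervals are $\emptyset$, singletons and $V$. Embedding: isomorphism onto an induced subgraph. Within a class $\mathcal{K}$ of finite indecomposable graphs (up to isomorphism), a subclass is hereditary if it contains every member of $\mathcal{K}$ embeddable into one of its members, and it is minimal if it is hereditary, infinite, and every proper hereditary subclass is finite. -}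

module Defs where

open import Data.Nat using (ℕ)
open import Data.Fin using (Fin)
open import Data.Bool using (Bool; true; false)
open import Data.List using (List)
open import Data.List.Membership.Propositional using (_∈_)
open import Data.Product using (Σ; ∃; _×_; _,_)
open import Data.Sum using (_⊎_)
open import Relation.Nullary using (¬_)
open import Relation.Binary.PropositionalEquality using (_≡_; _≢_)
open import Relation.Unary using (Pred)
open import Level using (0ℓ)
open import Function.Definitions using (Injective; Surjective)

-- A finite graph (binary relation) on the vertex set Fin n.
-- rel x y ≡ true  means  x ρ y.
record Graph : Set where
  constructor mkGraph
  field
    size : ℕ
    rel  : Fin size → Fin size → Bool
open Graph public

Loopless : Graph → Set
Loopless G = ∀ x → rel G x x ≡ false

-- symmetric relation (undirected graph, loops allowed)
Symmetric : Graph → Set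
Symmetric G = ∀ x y → rel G x y ≡ rel G y x

Subset : Graph → Set
Subset G = Fin (size G) → Bool

IsInterval : (G : Graph) → Subset G → Set
IsInterval G A =
  ∀ a a' x → A a ≡ true → A a' ≡ true → A x ≡ false →
  (rel G x a ≡ rel G x a') × (rel G a x ≡ rel G a' x)

IsEmpty : (G : Graph) → Subset G → Set
IsEmpty G A = ∀ x → A x ≡ false

IsSingleton : (G : Graph) → Subset G → Set
IsSingleton G A = ∃ λ v → ∀ x → (A x ≡ true → x ≡ v) × (x ≡ v → A x ≡ true)

IsFull : (G : Graph) → Subset G → Set
IsFull G A = ∀ x → A x ≡ true

Indecomposable : Graph → Set
Indecomposable G =
  ∀ (A : Subset G) → IsInterval G A → IsEmpty G A ⊎ IsSingleton G A ⊎ IsFull G A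

record Embedding (G H : Graph) : Set where
  field
    map       : Fin (size G) → Fin (size H)
    injective : Injective _≡_ _≡_ map
    preserves : ∀ x y → rel H (map x) (map y) ≡ rel G x y

record Iso (G H : Graph) : Set where
  field
    emb        : Embedding G H
    surjective : Surjective _≡_ _≡_ (Embedding.map emb)

Class : Set₁
Class = Pred Graph 0ℓ

DirLooplessIndec : Class
DirLooplessIndec G = Loopless G × Indecomposable G

UndirLoopsIndec : Class
UndirLoopsIndec G = Symmetric G × Indecomposable G

_⊆C_ : Class → Class → Set
C ⊆C D = ∀ G → C G → D G

Hereditary : Class → Class → Set
Hereditary K C =
  C ⊆C K × (∀ G H → K G → C H → Embedding G H → C G)

FiniteUpToIso : Class → Set
FiniteUpToIso C = ∃ λ (L : List Graph) → ∀ G → C G → ∃ λ H → (H ∈ L) × Iso G H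

InfiniteUpToIso : Class → Set
InfiniteUpToIso C = ¬ FiniteUpToIso C

ProperSub : Class → Class → Set
ProperSub D C = D ⊆C C × ∃ λ G → C G × ¬ D G

Minimal : Class → Class → Set₁
Minimal K C =
  Hereditary K C × InfiniteUpToIso C ×
  (∀ (D : Class) → Hereditary K D → ProperSub D C → FiniteUpToIso D)

SameClass : Class → Class → Set
SameClass C D = C ⊆C D × D ⊆C C

-- continuum many: an injective family of minimal classes indexed by 2^ℕ
ContinuumManyMinimal : Class → Set₁
ContinuumManyMinimal K =
  Σ ((ℕ → Bool) → Class) λ F →
    (∀ a → Minimal K (F a)) ×
    (∀ a b → SameClass (F a) (F b) → ∀ n → a n ≡ b n)

-- Decorate the path 0 — 1 — 2 — ⋯ by a 0/1-word w: a loop at i iff w i (undirected case), or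
-- arcs i → i+1 plus a back arc i+1 → i iff w i (directed case). Its finite subpaths with at least
-- four vertices are indecomposable, and an indecomposable graph embedded into such a path occupies
-- an interval of it. Hence if w is uniformly recurrent, every large indecomposable graph embeddable
-- into the infinite path contains any prescribed prefix path, so the class of these graphs is a
-- minimal hereditary class. For a : ℕ → Bool take the Toeplitz word made of 9-blocks
-- 0 0 a₀ 0 1 0 1 1 h whose holes h spell the word of (a₁, a₂, …). Its blocks can be neither shifted
-- nor mirrored onto themselves, so an embedding of a long prefix path of one such word into a path
-- of another is a block-aligned translation; reading the holes level by level recovers a n.

module Submission where

open import Defs
open import Data.Bool using (Bool; true; false)
import Data.Bool.Properties as Bool
open import Data.Maybe using (Maybe; just; nothing)
open import Data.Empty using (⊥; ⊥-elim)
open import Data.Fin using (Fin; toℕ; fromℕ<) renaming (zero to fzero; suc to fsuc)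
open import Data.Fin.Properties using (toℕ-injective; toℕ-fromℕ<; toℕ<n; injective⇒≤; any?)
open import Data.List as List using (List; []; _∷_; _++_; cartesianProduct; allFin)
open import Data.List.Membership.Propositional using (_∈_)
open import Data.List.Membership.Propositional.Properties
  using (∈-map⁺; ∈-++⁺ˡ; ∈-++⁺ʳ; ∈-cartesianProduct⁺; ∈-allFin)
open import Data.List.Relation.Unary.Any using (here; there)
import Data.List.Relation.Unary.All as All
open import Data.Nat
open import Data.Nat.DivMod
open import Data.Nat.Divisibility using (divides-refl)
open import Data.Nat.Tactic.RingSolver using (solve-∀)
open import Data.Nat.Properties
open import Data.Product using (∃; ∃₂; _×_; _,_; proj₁; proj₂; uncurry)
open import Data.Sum as Sum using (_⊎_; inj₁; inj₂)
open import Data.Vec using (Vec; []; _∷_; lookup; tabulate)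
open import Data.Vec.Properties using (lookup∘tabulate)
open import Function using (_∘_)
open import Relation.Nullary using (¬_; Dec; yes; no; does; contradiction)
open import Relation.Nullary.Decidable using (dec-true; dec-false; ¬?; _→-dec_; from-yes)
open import Relation.Binary.PropositionalEquality

open import Data.List.Extrema ≤-totalOrder
  using (max; xs≤max; argmin; argmax; f[argmin]≤f[xs]; f[xs]≤f[argmax])

dec-true⁻¹ : ∀ {P : Set} (P? : Dec P) → does P? ≡ true → P
dec-true⁻¹ (yes p) _ = p

dec-false⁻¹ : ∀ {P : Set} (P? : Dec P) → does P? ≡ false → ¬ P
dec-false⁻¹ (no ¬p) _ = ¬p

idEmbedding : ∀ {G} → Embedding G G
idEmbedding = record { map = λ x → x ; injective = λ eq → eq ; preserves = λ _ _ → refl }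

_∘ᴱ_ : ∀ {G H K} → Embedding H K → Embedding G H → Embedding G K
f ∘ᴱ g = record
  { map       = λ x → F.map (G.map x)
  ; injective = λ eq → G.injective (F.injective eq)
  ; preserves = λ x y → trans (F.preserves _ _) (G.preserves x y)
  }
  where
  module F = Embedding f
  module G = Embedding g

place : ∀ {H G} → Embedding H G → Fin (size H) → ℕ
place e v = toℕ (Embedding.map e v)

embedding⇒size≤ : ∀ {G H} → Embedding G H → size G ≤ size H
embedding⇒size≤ e = injective⇒≤ (Embedding.injective e)

factorEmbedding : ∀ {G H K} (e : Embedding H G) (f : Embedding K G) →
                  (∀ k → ∃ λ h → Embedding.map e h ≡ Embedding.map f k) → Embedding K H
factorEmbedding {G} {H} {K} e f lift = record
  { map       = preimage
  ; injective = λ {k} {k'} eq → F.injective (begin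
      F.map k          ≡⟨ sym (proj₂ (lift k)) ⟩
      E.map (preimage k)  ≡⟨ cong E.map eq ⟩
      E.map (preimage k') ≡⟨ proj₂ (lift k') ⟩
      F.map k'         ∎)
  ; preserves = λ k k' → begin
      rel H (preimage k) (preimage k')           ≡⟨ sym (E.preserves _ _) ⟩
      rel G (E.map (preimage k)) (E.map (preimage k')) ≡⟨ cong₂ (rel G) (proj₂ (lift k)) (proj₂ (lift k')) ⟩
      rel G (F.map k) (F.map k')                 ≡⟨ F.preserves k k' ⟩
      rel K k k'                                 ∎
  }
  where
  module E = Embedding e
  module F = Embedding f
  open ≡-Reasoning
  preimage : Fin (size K) → Fin (size H)
  preimage k = proj₁ (lift k)

vectors : ∀ {A : Set} n → List A → List (Vec A n)
vectors zero    xs = [] ∷ []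
vectors (suc n) xs = List.map (uncurry _∷_) (cartesianProduct xs (vectors n xs))

∈-vectors : ∀ {A : Set} {xs : List A} → (∀ x → x ∈ xs) → ∀ {n} (v : Vec A n) → v ∈ vectors n xs
∈-vectors all []      = here refl
∈-vectors all (x ∷ v) = ∈-map⁺ (uncurry _∷_) (∈-cartesianProduct⁺ (all x) (∈-vectors all v))

matrixGraph : ∀ n → Vec (Vec Bool n) n → Graph
matrixGraph n M = mkGraph n (λ i j → lookup (lookup M i) j)

graphsOfSize : ℕ → List Graph
graphsOfSize n = List.map (matrixGraph n) (vectors n (vectors n (true ∷ false ∷ [])))

graphsUpTo : ℕ → List Graph
graphsUpTo zero    = graphsOfSize zero
graphsUpTo (suc B) = graphsOfSize (suc B) ++ graphsUpTo B

∈-graphsOfSize : ∀ {n} (M : Vec (Vec Bool n) n) → matrixGraph n M ∈ graphsOfSize n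
∈-graphsOfSize M = ∈-map⁺ (matrixGraph _) (∈-vectors (∈-vectors allBools) M)
  where
  allBools : ∀ b → b ∈ true ∷ false ∷ []
  allBools true  = here refl
  allBools false = there (here refl)

∈-graphsUpTo : ∀ {n B} → n ≤ B → (M : Vec (Vec Bool n) n) → matrixGraph n M ∈ graphsUpTo B
∈-graphsUpTo {B = zero} z≤n M = ∈-graphsOfSize M
∈-graphsUpTo {B = suc B} n≤B M with m≤n⇒m<n∨m≡n n≤B
... | inj₁ n<1+B = ∈-++⁺ʳ (graphsOfSize (suc B)) (∈-graphsUpTo (≤-pred n<1+B) M)
... | inj₂ refl  = ∈-++⁺ˡ (∈-graphsOfSize M)

pointwise⇒iso : ∀ {n} {r r' : Fin n → Fin n → Bool} →
                (∀ i j → r i j ≡ r' i j) → Iso (mkGraph n r) (mkGraph n r')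
pointwise⇒iso r≗r' = record
  { emb        = record { map = λ x → x ; injective = λ eq → eq ; preserves = λ i j → sym (r≗r' i j) }
  ; surjective = λ y → y , λ eq → eq
  }

boundedSize⇒finite : ∀ (C : Class) B → (∀ G → C G → size G ≤ B) → FiniteUpToIso C
boundedSize⇒finite C B bounded = graphsUpTo B , λ G CG →
  matrixGraph (size G) (matrix G) , ∈-graphsUpTo (bounded G CG) (matrix G) , pointwise⇒iso (lookup-matrix G)
  where
  matrix : ∀ G → Vec (Vec Bool (size G)) (size G)
  matrix G = tabulate (λ i → tabulate (rel G i))
  lookup-matrix : ∀ G i j → rel G i j ≡ lookup (lookup (matrix G) i) j
  lookup-matrix G i j = sym (trans (cong (λ row → lookup row j) (lookup∘tabulate _ i)) (lookup∘tabulate _ j))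

finite⇒boundedSize : ∀ {C} → FiniteUpToIso C → ∃ λ B → ∀ G → C G → size G ≤ B
finite⇒boundedSize {C} (L , cover) = max 0 (List.map size L) , bounded
  where
  bounded : ∀ G → C G → size G ≤ max 0 (List.map size L)
  bounded G CG with cover G CG
  ... | H , H∈L , G≅H =
    ≤-trans (embedding⇒size≤ (Iso.emb G≅H)) (All.lookup (xs≤max 0 (List.map size L)) (∈-map⁺ size H∈L))

unbounded⇒infinite : ∀ {C} → (∀ B → ∃ λ G → C G × B < size G) → InfiniteUpToIso C
unbounded⇒infinite unbounded finite with finite⇒boundedSize finite
... | B , bounded with unbounded B
...   | G , CG , B<G = <⇒≱ B<G (bounded G CG)

lowest : ∀ {s} (f : Fin s → ℕ) → Fin s → ∃ λ v → ∀ u → f v ≤ f u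
lowest f v₀ = argmin f v₀ (allFin _) , λ u → All.lookup (f[argmin]≤f[xs] v₀ (allFin _)) (∈-allFin u)

highest : ∀ {s} (f : Fin s → ℕ) → Fin s → ∃ λ v → ∀ u → f u ≤ f v
highest f v₀ = argmax f v₀ (allFin _) , λ u → All.lookup (f[xs]≤f[argmax] v₀ (allFin _)) (∈-allFin u)

injective⇒size≤range : ∀ {s lo hi} (f : Fin s → ℕ) → (∀ {x y} → f x ≡ f y → x ≡ y) →
                       (∀ x → lo ≤ f x) → (∀ x → f x ≤ hi) → s ≤ suc (hi ∸ lo)
injective⇒size≤range {s} {lo} {hi} f f-injective lo≤f f≤hi = injective⇒≤ {f = fromLowest} λ {x} {y} eq →
  f-injective (∸-cancelʳ-≡ (lo≤f x) (lo≤f y)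
                (trans (sym (toℕ-fromℕ< _)) (trans (cong toℕ eq) (toℕ-fromℕ< _))))
  where
  fromLowest : Fin s → Fin (suc (hi ∸ lo))
  fromLowest x = fromℕ< (s≤s (∸-monoˡ-≤ lo (f≤hi x)))

module _ {H : Graph} (indecomposable : Indecomposable H) where

  properInterval⇒singleton : ∀ {A a a'} → IsInterval H A → A a ≡ true → A a' ≡ false →
                             ∃ λ c → ∀ x → A x ≡ true → x ≡ c
  properInterval⇒singleton {A} {a} {a'} int Aa Aa' with indecomposable A int
  ... | inj₁ empty             = contradiction (trans (sym (empty a)) Aa) λ ()
  ... | inj₂ (inj₁ (c , only)) = c , λ x Ax → proj₁ (only x) Ax
  ... | inj₂ (inj₂ full)       = contradiction (trans (sym (full a')) Aa') λ ()

  coveringIntervals⇒size≤2 : ∀ {A B a a' b b'} → IsInterval H A → IsInterval H B →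
                             A a ≡ true → A a' ≡ false → B b ≡ true → B b' ≡ false →
                             (∀ x → A x ≡ false → B x ≡ true) → size H ≤ 2
  coveringIntervals⇒size≤2 {A} {B} intA intB Aa Aa' Bb Bb' cover = injective⇒≤ side-injective
    where
    bit : Bool → Fin 2
    bit true  = fzero
    bit false = fsuc fzero
    singleA : ∃ λ c → ∀ x → A x ≡ true → x ≡ c
    singleA = properInterval⇒singleton intA Aa Aa'
    singleB : ∃ λ c → ∀ x → B x ≡ true → x ≡ c
    singleB = properInterval⇒singleton intB Bb Bb'
    side-injective : ∀ {x y} → bit (A x) ≡ bit (A y) → x ≡ y
    side-injective {x} {y} eq with A x in Ax | A y in Ay
    ... | true  | true  = trans (proj₂ singleA x Ax) (sym (proj₂ singleA y Ay))
    ... | false | false = trans (proj₂ singleB x (cover x Ax)) (sym (proj₂ singleB y (cover y Ay)))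
    ... | true  | false = contradiction eq λ ()
    ... | false | true  = contradiction eq λ ()

Adjacent : ℕ → ℕ → Set
Adjacent a b = b ≡ suc a ⊎ a ≡ suc b

Far : ℕ → ℕ → Set
Far a b = 2 + a ≤ b ⊎ 2 + b ≤ a

far-sym : ∀ {a b} → Far a b → Far b a
far-sym = Sum.swap

far⇒¬adjacent : ∀ {a b} → Far a b → ¬ Adjacent a b
far⇒¬adjacent (inj₁ 2+a≤b) (inj₁ refl) = 1+n≰n (≤-pred 2+a≤b)
far⇒¬adjacent (inj₁ 2+a≤b) (inj₂ refl) = 1+n≰n (≤-trans (m≤n+m _ 2) 2+a≤b)
far⇒¬adjacent (inj₂ 2+b≤a) (inj₁ refl) = 1+n≰n (≤-trans (m≤n+m _ 2) 2+b≤a)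
far⇒¬adjacent (inj₂ 2+b≤a) (inj₂ refl) = 1+n≰n (≤-pred 2+b≤a)

compareDistance : ∀ a b → a ≡ b ⊎ Adjacent a b ⊎ Far a b
compareDistance zero          zero          = inj₁ refl
compareDistance zero          (suc zero)    = inj₂ (inj₁ (inj₁ refl))
compareDistance zero          (suc (suc b)) = inj₂ (inj₂ (inj₁ (s≤s (s≤s z≤n))))
compareDistance (suc zero)    zero          = inj₂ (inj₁ (inj₂ refl))
compareDistance (suc (suc a)) zero          = inj₂ (inj₂ (inj₂ (s≤s (s≤s z≤n))))
compareDistance (suc a)       (suc b)       =
  Sum.map (cong suc) (Sum.map (Sum.map (cong suc) (cong suc)) (Sum.map s≤s s≤s)) (compareDistance a b)

constant-or-switches : ∀ {m} (A : Fin (suc m) → Bool) →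
  (∀ x → A x ≡ A fzero) ⊎ ∃₂ λ x y → Adjacent (toℕ x) (toℕ y) × A x ≡ false × A y ≡ true
constant-or-switches {zero} A = inj₁ λ { fzero → refl }
constant-or-switches {suc m} A
  with A fzero in A0 | A (fsuc fzero) in A1 | constant-or-switches (λ x → A (fsuc x))
... | false | true  | _ = inj₂ (fzero , fsuc fzero , inj₁ refl , A0 , A1)
... | true  | false | _ = inj₂ (fsuc fzero , fzero , inj₂ refl , A1 , A0)
... | _     | _     | inj₂ (x , y , adjacent , Ax , Ay) =
  inj₂ (fsuc x , fsuc y , Sum.map (cong suc) (cong suc) adjacent , Ax , Ay)
... | true  | true  | inj₁ constant = inj₁ λ { fzero → A0 ; (fsuc x) → constant x }
... | false | false | inj₁ constant = inj₁ λ { fzero → A0 ; (fsuc x) → constant x }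

-- Path-like graphs

record PathLike (G : Graph) : Set where
  field
    next-related  : ∀ {i j} → toℕ j ≡ suc (toℕ i) → rel G i j ≡ true
    far-unrelated : ∀ {i j} → Far (toℕ i) (toℕ j) → rel G i j ≡ false

module _ {G : Graph} (pathLike : PathLike G) where
  open PathLike pathLike

  adjacent⇒related : ∀ {i j} → Adjacent (toℕ i) (toℕ j) → rel G i j ≡ true ⊎ rel G j i ≡ true
  adjacent⇒related = Sum.map next-related next-related

  module _ {A : Subset G} (int : IsInterval G A) where

    interval-adjacent : ∀ {x y z} → A x ≡ false → A y ≡ true → A z ≡ true →
                        Adjacent (toℕ x) (toℕ y) → Adjacent (toℕ x) (toℕ z)
    interval-adjacent {x} {y} {z} Ax Ay Az xy with compareDistance (toℕ x) (toℕ z) | int y z x Ay Az Ax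
    ... | inj₁ x≡z        | _ = contradiction (trans (sym Ax) (trans (cong A (toℕ-injective x≡z)) Az)) λ ()
    ... | inj₂ (inj₁ xz)  | _ = xz
    ... | inj₂ (inj₂ far) | rxy≡rxz , ryx≡rzx with adjacent⇒related xy
    ...   | inj₁ rxy = contradiction (trans (sym rxy) (trans rxy≡rxz (far-unrelated far))) λ ()
    ...   | inj₂ ryx = contradiction (trans (sym ryx) (trans ryx≡rzx (far-unrelated (far-sym far)))) λ ()

    -- z is far from the outsider x but adjacent to a member of A: both A z and ¬ A z are refuted.
    interval-noGap : ∀ {x z member other} → A x ≡ false → A member ≡ true → A other ≡ true →
                     Adjacent (toℕ x) (toℕ member) → Adjacent (toℕ z) (toℕ member) →
                     Far (toℕ x) (toℕ z) → Far (toℕ z) (toℕ other) → ⊥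
    interval-noGap {z = z} Ax Am Ao xm zm xz zo with A z in Az
    ... | true  = far⇒¬adjacent xz (interval-adjacent Ax Am Az xm)
    ... | false = far⇒¬adjacent zo (interval-adjacent Az Am Ao zm)

    -- A fourth vertex, right of u' or left of u, is refuted by interval-noGap.
    interval-noSandwich : ∀ {u x u'} → 4 ≤ size G → A u ≡ true → A x ≡ false → A u' ≡ true →
                          toℕ x ≡ suc (toℕ u) → toℕ u' ≡ suc (toℕ x) → ⊥
    interval-noSandwich {u} {x} {u'} 4≤n Au Ax Au' x≡1+u u'≡1+x with suc (toℕ u') <? size G
    ... | yes u'+1<n =
      interval-noGap Ax Au' Au (inj₁ u'≡1+x) (inj₂ z≡1+u') (inj₁ (≤-reflexive (sym z≡2+x)))
                     (inj₂ (≤-trans (n≤1+n _) (≤-reflexive (sym (trans z≡2+x (cong (2 +_) x≡1+u))))))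
      where
      z≡1+u' : toℕ (fromℕ< u'+1<n) ≡ suc (toℕ u')
      z≡1+u' = toℕ-fromℕ< u'+1<n
      z≡2+x : toℕ (fromℕ< u'+1<n) ≡ 2 + toℕ x
      z≡2+x = trans z≡1+u' (cong suc u'≡1+x)
    ... | no u'+1≮n = leftOf (toℕ u) refl
      where
      u'≡2+u : toℕ u' ≡ 2 + toℕ u
      u'≡2+u = trans u'≡1+x (cong suc x≡1+u)
      leftOf : ∀ k → toℕ u ≡ k → ⊥
      leftOf zero    u≡0   = u'+1≮n (subst (λ k → 2 + k ≤ size G) (sym (trans u'≡2+u (cong (2 +_) u≡0))) 4≤n)
      leftOf (suc k) u≡1+k =
        interval-noGap Ax Au Au' (inj₂ x≡1+u) (inj₁ u≡1+z) (inj₂ (≤-reflexive (sym x≡2+z)))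
                       (inj₁ (≤-trans (n≤1+n _) (≤-reflexive (sym (trans u'≡2+u (cong (2 +_) u≡1+z))))))
        where
        k<n : k < size G
        k<n = <⇒≤ (subst (_< size G) u≡1+k (toℕ<n u))
        u≡1+z : toℕ u ≡ suc (toℕ (fromℕ< k<n))
        u≡1+z = trans u≡1+k (cong suc (sym (toℕ-fromℕ< k<n)))
        x≡2+z : toℕ x ≡ 2 + toℕ (fromℕ< k<n)
        x≡2+z = trans x≡1+u (cong suc u≡1+z)

pathLike⇒indecomposable : ∀ {G} → PathLike G → 4 ≤ size G → Indecomposable G
pathLike⇒indecomposable {mkGraph (suc m) r} pathLike 4≤n A int with constant-or-switches A
... | inj₁ constant with A fzero
...   | false = inj₁ constant
...   | true  = inj₂ (inj₂ constant)
pathLike⇒indecomposable {mkGraph (suc m) r} pathLike 4≤n A int | inj₂ (x , y , xy , Ax , Ay) =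
  inj₂ (inj₁ (y , λ z → (λ Az → toℕ-injective (sides xy (interval-adjacent pathLike int Ax Ay Az xy) Az)) ,
                        λ { refl → Ay }))
  where
  sides : ∀ {z} → Adjacent (toℕ x) (toℕ y) → Adjacent (toℕ x) (toℕ z) → A z ≡ true → toℕ z ≡ toℕ y
  sides (inj₁ y≡1+x) (inj₁ z≡1+x) Az = trans z≡1+x (sym y≡1+x)
  sides (inj₂ x≡1+y) (inj₂ x≡1+z) Az = suc-injective (trans (sym x≡1+z) x≡1+y)
  sides (inj₁ y≡1+x) (inj₂ x≡1+z) Az = ⊥-elim (interval-noSandwich pathLike int 4≤n Az Ax Ay x≡1+z y≡1+x)
  sides (inj₂ x≡1+y) (inj₁ z≡1+x) Az = ⊥-elim (interval-noSandwich pathLike int 4≤n Ay Ax Az x≡1+y z≡1+x)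

module _ {H G : Graph} (indecomposable : Indecomposable H) (pathLike : PathLike G) (e : Embedding H G) where
  open PathLike pathLike

  separated⇒interval : ∀ {A : Subset H} → (∀ a x → A a ≡ true → A x ≡ false → Far (place e a) (place e x)) →
                       IsInterval H A
  separated⇒interval separated a a' x Aa Aa' Ax =
    trans (unrelated x a (far-sym (separated a x Aa Ax))) (sym (unrelated x a' (far-sym (separated a' x Aa' Ax)))) ,
    trans (unrelated a x (separated a x Aa Ax)) (sym (unrelated a' x (separated a' x Aa' Ax)))
    where
    unrelated : ∀ u v → Far (place e u) (place e v) → rel H u v ≡ false
    unrelated u v far = trans (sym (Embedding.preserves e u v)) (far-unrelated far)

  -- A missed p would split H into the two intervals of vertices placed below and above p.
  convexImage : 3 ≤ size H → ∀ {v v' p} → place e v ≤ p → p ≤ place e v' → ∃ λ u → place e u ≡ p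
  convexImage 3≤H {v} {v'} {p} v≤p p≤v' with any? (λ u → place e u ≟ p)
  ... | yes hit = hit
  ... | no miss = ⊥-elim (<⇒≱ 3≤H (coveringIntervals⇒size≤2 indecomposable
                    (separated⇒interval below-separated) (separated⇒interval above-separated)
                    (dec-true (place e v <? p) (≤∧≢⇒< v≤p (missed v)))
                    (dec-false (place e v' <? p) (≤⇒≯ p≤v'))
                    (dec-true (p <? place e v') (≤∧≢⇒< p≤v' (missed v' ∘ sym)))
                    (dec-false (p <? place e v) (≤⇒≯ v≤p))
                    cover))
    where
    missed : ∀ u → place e u ≢ p
    missed u eq = miss (u , eq)
    beyond : ∀ {x} → ¬ place e x < p → p < place e x
    beyond {x} x≮p = ≤∧≢⇒< (≮⇒≥ x≮p) (missed x ∘ sym)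
    below-separated : ∀ a x → does (place e a <? p) ≡ true → does (place e x <? p) ≡ false →
                      Far (place e a) (place e x)
    below-separated a x Aa Ax =
      inj₁ (≤-trans (s≤s (dec-true⁻¹ (place e a <? p) Aa)) (beyond (dec-false⁻¹ (place e x <? p) Ax)))
    above-separated : ∀ a x → does (p <? place e a) ≡ true → does (p <? place e x) ≡ false →
                      Far (place e a) (place e x)
    above-separated a x Aa Ax =
      inj₂ (≤-trans (s≤s (≤∧≢⇒< (≮⇒≥ (dec-false⁻¹ (p <? place e x) Ax)) (missed x))) (dec-true⁻¹ (p <? place e a) Aa))
    cover : ∀ x → does (place e x <? p) ≡ false → does (p <? place e x) ≡ true
    cover x Ax = dec-true (p <? place e x) (beyond (dec-false⁻¹ (place e x <? p) Ax))

Translation Reflection : (ℕ → ℕ) → ℕ → Set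
Translation E M = ∀ j → j ≤ M → E j ≡ E 0 + j
Reflection  E M = ∀ j → j ≤ M → E j + j ≡ E 0

module _ (E : ℕ → ℕ) (M : ℕ)
         (unitStep : ∀ j → suc j ≤ M → Adjacent (E j) (E (suc j)))
         (noBacktrack : ∀ j → 2 + j ≤ M → E (2 + j) ≢ E j) where

  forward-steps : E 1 ≡ suc (E 0) → ∀ j → suc j ≤ M → E (suc j) ≡ suc (E j)
  forward-steps forward zero    _  = forward
  forward-steps forward (suc j) le with unitStep (suc j) le
  ... | inj₁ step = step
  ... | inj₂ back = contradiction (suc-injective (trans (sym back) (forward-steps forward j (≤-trans (n≤1+n _) le))))
                                  (noBacktrack j le)

  backward-steps : E 0 ≡ suc (E 1) → ∀ j → suc j ≤ M → E j ≡ suc (E (suc j))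
  backward-steps backward zero    _  = backward
  backward-steps backward (suc j) le with unitStep (suc j) le
  ... | inj₂ step = step
  ... | inj₁ fwd  = contradiction (trans fwd (sym (backward-steps backward j (≤-trans (n≤1+n _) le))))
                                  (noBacktrack j le)

  walk-forward : E 1 ≡ suc (E 0) → Translation E M
  walk-forward forward zero    _  = sym (+-identityʳ _)
  walk-forward forward (suc j) le = begin
    E (suc j)       ≡⟨ forward-steps forward j le ⟩
    suc (E j)       ≡⟨ cong suc (walk-forward forward j (≤-trans (n≤1+n _) le)) ⟩
    suc (E 0 + j)   ≡⟨ +-suc (E 0) j ⟨
    E 0 + suc j     ∎
    where open ≡-Reasoning

  walk-backward : E 0 ≡ suc (E 1) → Reflection E M
  walk-backward backward zero    _  = +-identityʳ _
  walk-backward backward (suc j) le = begin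
    E (suc j) + suc j   ≡⟨ +-suc (E (suc j)) j ⟩
    suc (E (suc j)) + j ≡⟨ cong (_+ j) (backward-steps backward j le) ⟨
    E j + j             ≡⟨ walk-backward backward j (≤-trans (n≤1+n _) le) ⟩
    E 0                 ∎
    where open ≡-Reasoning

  walk-monotone : 1 ≤ M → Translation E M ⊎ Reflection E M
  walk-monotone 1≤M = Sum.map walk-forward walk-backward (unitStep 0 1≤M)

translation⇒step : ∀ {E M} → Translation E M → ∀ j → suc j ≤ M → E (suc j) ≡ suc (E j)
translation⇒step {E} translation j 1+j≤M = begin
  E (suc j)     ≡⟨ translation (suc j) 1+j≤M ⟩
  E 0 + suc j   ≡⟨ +-suc (E 0) j ⟩
  suc (E 0 + j) ≡⟨ cong suc (translation j (≤-trans (n≤1+n j) 1+j≤M)) ⟨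
  suc (E j)     ∎
  where open ≡-Reasoning

module EmbeddedPath {M : ℕ} {r : Fin (suc M) → Fin (suc M) → Bool} {G : Graph}
                    (pathLike : PathLike (mkGraph (suc M) r)) (pathLike' : PathLike G)
                    (e : Embedding (mkGraph (suc M) r) G) where
  open Embedding e public

  -- Used only for j ≤ M, where it is the vertex j; the modulus merely makes it total.
  vertex : ℕ → Fin (suc M)
  vertex j = j mod suc M

  image : ℕ → ℕ
  image j = place e (vertex j)

  toℕ-vertex : ∀ {j} → j ≤ M → toℕ (vertex j) ≡ j
  toℕ-vertex j≤M = trans (toℕ-fromℕ< _) (m<n⇒m%n≡m (s≤s j≤M))

  image-injective : ∀ {i j} → i ≤ M → j ≤ M → image i ≡ image j → i ≡ j
  image-injective i≤M j≤M eq =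
    trans (sym (toℕ-vertex i≤M)) (trans (cong toℕ (injective (toℕ-injective eq))) (toℕ-vertex j≤M))

  rel-vertex : ∀ i j → rel G (map (vertex i)) (map (vertex j)) ≡ r (vertex i) (vertex j)
  rel-vertex i j = preserves (vertex i) (vertex j)

  unitStep : ∀ j → suc j ≤ M → Adjacent (image j) (image (suc j))
  unitStep j 1+j≤M with compareDistance (image j) (image (suc j))
  ... | inj₁ same       = contradiction (image-injective (≤-trans (n≤1+n j) 1+j≤M) 1+j≤M same)
                                         λ j≡1+j → 1+n≰n (≤-reflexive (sym j≡1+j))
  ... | inj₂ (inj₁ adj) = adj
  ... | inj₂ (inj₂ far) =
    contradiction (trans (sym related) (trans (sym (rel-vertex j (suc j))) (PathLike.far-unrelated pathLike' far))) λ ()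
    where
    related : r (vertex j) (vertex (suc j)) ≡ true
    related = PathLike.next-related pathLike
                (trans (toℕ-vertex 1+j≤M) (cong suc (sym (toℕ-vertex (≤-trans (n≤1+n j) 1+j≤M)))))

  noBacktrack : ∀ j → 2 + j ≤ M → image (2 + j) ≢ image j
  noBacktrack j 2+j≤M eq = contradiction (image-injective 2+j≤M (≤-trans (m≤n+m j 2) 2+j≤M) eq)
                           λ 2+j≡j → 1+n≰n (≤-trans (n≤1+n _) (≤-reflexive 2+j≡j))

  image-monotone : 1 ≤ M → Translation image M ⊎ Reflection image M
  image-monotone = walk-monotone image M unitStep noBacktrack

-- Paths decorated by a word

data Kind : Set where
  undirected directed : Kind

Ambient : Kind → Class
Ambient undirected = UndirLoopsIndec
Ambient directed   = DirLooplessIndec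

ambient⇒indecomposable : ∀ κ {G} → Ambient κ G → Indecomposable G
ambient⇒indecomposable undirected = proj₂
ambient⇒indecomposable directed   = proj₂

data Offset : Set where
  equal after before apart : Offset

offset : ℕ → ℕ → Offset
offset (suc i)       (suc j)       = offset i j
offset zero          zero          = equal
offset zero          (suc zero)    = after
offset zero          (suc (suc _)) = apart
offset (suc zero)    zero          = before
offset (suc (suc _)) zero          = apart

edge : Kind → Offset → Bool → Bool → Bool
edge _          apart  _ _ = false
edge _          after  _ _ = true
edge undirected equal  x _ = x
edge undirected before _ _ = true
edge directed   equal  _ _ = false
edge directed   before _ y = y

-- The path 0 — 1 — ⋯ — (n-1) decorated by w: undirected, with a loop at i iff w i; or directed,
-- with i → i+1 always and i+1 → i iff w i.
path : Kind → (ℕ → Bool) → ℕ → Graph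
path κ w n = mkGraph n (λ i j → edge κ (offset (toℕ i) (toℕ j)) (w (toℕ i)) (w (toℕ j)))

offset-refl : ∀ i → offset i i ≡ equal
offset-refl zero    = refl
offset-refl (suc i) = offset-refl i

offset-after : ∀ i → offset i (suc i) ≡ after
offset-after zero    = refl
offset-after (suc i) = offset-after i

offset-before : ∀ i → offset (suc i) i ≡ before
offset-before zero    = refl
offset-before (suc i) = offset-before i

offset-apart : ∀ {i j} → Far i j → offset i j ≡ apart
offset-apart {zero}        {suc (suc j)} _   = refl
offset-apart {suc (suc i)} {zero}        _   = refl
offset-apart {suc i}       {suc j}       far = offset-apart (Sum.map ≤-pred ≤-pred far)
offset-apart {zero}        {zero}        (inj₁ ())
offset-apart {zero}        {zero}        (inj₂ ())
offset-apart {zero}        {suc zero}    (inj₁ (s≤s ()))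
offset-apart {zero}        {suc zero}    (inj₂ ())
offset-apart {suc zero}    {zero}        (inj₁ ())
offset-apart {suc zero}    {zero}        (inj₂ (s≤s ()))

offset-shift : ∀ q i j → offset (q + i) (q + j) ≡ offset i j
offset-shift zero    i j = refl
offset-shift (suc q) i j = offset-shift q i j

path-rel : ∀ κ w {n} (i j : Fin n) {o} → offset (toℕ i) (toℕ j) ≡ o →
           rel (path κ w n) i j ≡ edge κ o (w (toℕ i)) (w (toℕ j))
path-rel κ w i j = cong (λ o → edge κ o (w (toℕ i)) (w (toℕ j)))

path-before : ∀ κ w {n} (i j : Fin n) → toℕ i ≡ suc (toℕ j) →
              rel (path κ w n) i j ≡ edge κ before (w (toℕ i)) (w (toℕ j))
path-before κ w i j i≡1+j =
  path-rel κ w i j (trans (cong (λ k → offset k (toℕ j)) i≡1+j) (offset-before (toℕ j)))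

path-pathLike : ∀ κ w n → PathLike (path κ w n)
path-pathLike κ w n = record
  { next-related  = λ {i} {j} j≡1+i →
                      path-rel κ w i j (trans (cong (offset (toℕ i)) j≡1+i) (offset-after (toℕ i)))
  ; far-unrelated = λ {i} {j} far → path-rel κ w i j (offset-apart far)
  }

path-loop : ∀ w {n} (i : Fin n) → rel (path undirected w n) i i ≡ w (toℕ i)
path-loop w i = path-rel undirected w i i (offset-refl (toℕ i))

path-symmetric : ∀ w n → Symmetric (path undirected w n)
path-symmetric w n i j with compareDistance (toℕ i) (toℕ j)
... | inj₁ i≡j with refl ← toℕ-injective i≡j = refl
... | inj₂ (inj₁ (inj₁ j≡1+i)) =
  trans (PathLike.next-related (path-pathLike undirected w n) j≡1+i) (sym (path-before undirected w j i j≡1+i))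
... | inj₂ (inj₁ (inj₂ i≡1+j)) =
  trans (path-before undirected w i j i≡1+j) (sym (PathLike.next-related (path-pathLike undirected w n) i≡1+j))
... | inj₂ (inj₂ far) = trans (PathLike.far-unrelated (path-pathLike undirected w n) far)
                              (sym (PathLike.far-unrelated (path-pathLike undirected w n) (far-sym far)))

path-loopless : ∀ w n → Loopless (path directed w n)
path-loopless w n i = path-rel directed w i i (offset-refl (toℕ i))

path-ambient : ∀ κ w n → 4 ≤ n → Ambient κ (path κ w n)
path-ambient undirected w n 4≤n = path-symmetric w n , pathLike⇒indecomposable (path-pathLike undirected w n) 4≤n
path-ambient directed   w n 4≤n = path-loopless w n , pathLike⇒indecomposable (path-pathLike directed w n) 4≤n

path-window : ∀ {κ w w' m n} q → q + m ≤ n → (∀ j → j < m → w' (q + j) ≡ w j) →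
              Embedding (path κ w m) (path κ w' n)
path-window {κ} {w} {w'} {m} {n} q q+m≤n agree = record
  { map       = shift
  ; injective = λ {i} {j} eq → toℕ-injective (+-cancelˡ-≡ q _ _
                  (trans (sym (toℕ-shift i)) (trans (cong toℕ eq) (toℕ-shift j))))
  ; preserves = λ i j → begin
      edge κ (offset (toℕ (shift i)) (toℕ (shift j))) (w' (toℕ (shift i))) (w' (toℕ (shift j)))
        ≡⟨ cong₂ (λ a b → edge κ (offset a b) (w' a) (w' b)) (toℕ-shift i) (toℕ-shift j) ⟩
      edge κ (offset (q + toℕ i) (q + toℕ j)) (w' (q + toℕ i)) (w' (q + toℕ j))
        ≡⟨ cong (λ o → edge κ o (w' (q + toℕ i)) (w' (q + toℕ j))) (offset-shift q (toℕ i) (toℕ j)) ⟩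
      edge κ (offset (toℕ i) (toℕ j)) (w' (q + toℕ i)) (w' (q + toℕ j))
        ≡⟨ cong₂ (edge κ (offset (toℕ i) (toℕ j))) (agree (toℕ i) (toℕ<n i)) (agree (toℕ j) (toℕ<n j)) ⟩
      edge κ (offset (toℕ i) (toℕ j)) (w (toℕ i)) (w (toℕ j))
        ∎
  }
  where
  open ≡-Reasoning
  shift : Fin m → Fin n
  shift j = fromℕ< (<-≤-trans (+-monoʳ-< q (toℕ<n j)) q+m≤n)
  toℕ-shift : ∀ j → toℕ (shift j) ≡ q + toℕ j
  toℕ-shift j = toℕ-fromℕ< _

module _ (w w' : ℕ → Bool) {M N : ℕ} where

  module _ (e : Embedding (path undirected w (suc M)) (path undirected w' N)) where
    open EmbeddedPath (path-pathLike undirected w (suc M)) (path-pathLike undirected w' N) e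

    undirected-letters : ∀ j → j ≤ M → w j ≡ w' (image j)
    undirected-letters j j≤M = begin
      w j                                 ≡⟨ cong w (toℕ-vertex j≤M) ⟨
      w (toℕ (vertex j))                  ≡⟨ path-loop w (vertex j) ⟨
      rel (path undirected w (suc M)) (vertex j) (vertex j)        ≡⟨ rel-vertex j j ⟨
      rel (path undirected w' N) (map (vertex j)) (map (vertex j)) ≡⟨ path-loop w' (map (vertex j)) ⟩
      w' (image j)                        ∎
      where open ≡-Reasoning

  module _ (e : Embedding (path directed w (suc M)) (path directed w' N)) where
    open EmbeddedPath (path-pathLike directed w (suc M)) (path-pathLike directed w' N) e

    directed-letters : ∀ j → suc j ≤ M → image (suc j) ≡ suc (image j) → w j ≡ w' (image j)
    directed-letters j 1+j≤M forward = begin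
      w j                                 ≡⟨ cong w (toℕ-vertex j≤M) ⟨
      w (toℕ (vertex j))                  ≡⟨ path-before directed w (vertex (suc j)) (vertex j) vertex-step ⟨
      rel (path directed w (suc M)) (vertex (suc j)) (vertex j)        ≡⟨ rel-vertex (suc j) j ⟨
      rel (path directed w' N) (map (vertex (suc j))) (map (vertex j)) ≡⟨ path-before directed w' _ _ forward ⟩
      w' (image j)                        ∎
      where
      open ≡-Reasoning
      j≤M : j ≤ M
      j≤M = ≤-trans (n≤1+n j) 1+j≤M
      vertex-step : toℕ (vertex (suc j)) ≡ suc (toℕ (vertex j))
      vertex-step = trans (toℕ-vertex 1+j≤M) (cong suc (sym (toℕ-vertex j≤M)))

    directed-reversed⇒firstLetter : 1 ≤ M → image 0 ≡ suc (image 1) → w 0 ≡ true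
    directed-reversed⇒firstLetter 1≤M backward = begin
      w 0                                                 ≡⟨ path-before directed w (vertex 1) (vertex 0) (toℕ-vertex 1≤M) ⟨
      rel (path directed w (suc M)) (vertex 1) (vertex 0) ≡⟨ rel-vertex 1 0 ⟨
      rel (path directed w' N) (map (vertex 1)) (map (vertex 0))
        ≡⟨ PathLike.next-related (path-pathLike directed w' N) backward ⟩
      true                                                ∎
      where open ≡-Reasoning

-- A family of Toeplitz words

tail : (ℕ → Bool) → ℕ → Bool
tail a n = a (suc n)

block : Bool → Bool → ℕ → Bool
block a₀ hole 2 = a₀
block a₀ hole 4 = true
block a₀ hole 6 = true
block a₀ hole 7 = true
block a₀ hole 8 = hole
block a₀ hole _ = false

wordWithFuel : ℕ → (ℕ → Bool) → ℕ → Bool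
wordWithFuel zero    a x = false
wordWithFuel (suc f) a x = block (a 0) (wordWithFuel f (tail a) (x / 9)) (x % 9)

-- Position r + 9k (r < 9) of word a carries the r-th letter of 0 0 a₀ 0 1 0 1 1 h, where the hole h
-- is letter k of word (tail a). The fuel suc x suffices because x / 9 < x for x > 0.
word : (ℕ → Bool) → ℕ → Bool
word a x = wordWithFuel (suc x) a x

wordWithFuel-stable : ∀ f f' a x → x < f → x < f' → wordWithFuel f a x ≡ wordWithFuel f' a x
wordWithFuel-stable (suc f) (suc f') a zero    _          _           = refl
wordWithFuel-stable (suc f) (suc f') a (suc x) (s≤s x<f) (s≤s x<f') =
  cong (λ h → block (a 0) h (suc x % 9))
       (wordWithFuel-stable f f' (tail a) (suc x / 9) (<-≤-trans quotient< x<f) (<-≤-trans quotient< x<f'))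
  where
  quotient< : suc x / 9 < suc x
  quotient< = m/n<m (suc x) 9 (s≤s (s≤s z≤n))

word-unfold : ∀ a x → word a x ≡ block (a 0) (word (tail a) (x / 9)) (x % 9)
word-unfold a zero    = refl
word-unfold a (suc x) =
  cong (λ h → block (a 0) h (suc x % 9))
       (wordWithFuel-stable (suc x) (suc (suc x / 9)) (tail a) (suc x / 9)
                            (m/n<m (suc x) 9 (s≤s (s≤s z≤n))) (n<1+n _))

word-block : ∀ a {r} k → r < 9 → word a (r + k * 9) ≡ block (a 0) (word (tail a) k) r
word-block a {r} k r<9 =
  trans (word-unfold a (r + k * 9)) (cong₂ (λ q i → block (a 0) (word (tail a) q) i) quotient remainder)
  where
  quotient : (r + k * 9) / 9 ≡ k
  quotient = trans (+-distrib-/-∣ʳ r (divides-refl k)) (cong₂ _+_ (m<n⇒m/n≡0 r<9) (m*n/n≡m k 9))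
  remainder : (r + k * 9) % 9 ≡ r
  remainder = trans ([m+kn]%n≡m%n r k 9) (m<n⇒m%n≡m r<9)

block-cong : ∀ a₀ {h h'} r → (r ≡ 8 → h ≡ h') → block a₀ h r ≡ block a₀ h' r
block-cong a₀ 8 h≡h' = h≡h' refl
block-cong a₀ 0 _ = refl
block-cong a₀ 1 _ = refl
block-cong a₀ 2 _ = refl
block-cong a₀ 3 _ = refl
block-cong a₀ 4 _ = refl
block-cong a₀ 5 _ = refl
block-cong a₀ 6 _ = refl
block-cong a₀ 7 _ = refl
block-cong a₀ (suc (suc (suc (suc (suc (suc (suc (suc (suc _))))))))) _ = refl

word-periodic : ∀ K a i j → suc i < 9 ^ K → word a (i + j * 9 ^ K) ≡ word a i
word-periodic zero    a i j (s≤s ())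
word-periodic (suc K) a i j 1+i<9^K+1 with i divMod 9
... | result q r refl = begin
  word a (toℕ r + q * 9 + j * 9 ^ suc K)                  ≡⟨ cong (word a) (regroup (toℕ r) q j (9 ^ K)) ⟩
  word a (toℕ r + (q + j * 9 ^ K) * 9)                    ≡⟨ word-block a (q + j * 9 ^ K) (toℕ<n r) ⟩
  block (a 0) (word (tail a) (q + j * 9 ^ K)) (toℕ r)     ≡⟨ block-cong (a 0) (toℕ r) holes ⟩
  block (a 0) (word (tail a) q) (toℕ r)                   ≡⟨ word-block a q (toℕ<n r) ⟨
  word a (toℕ r + q * 9)                                  ∎
  where
  open ≡-Reasoning
  regroup : ∀ r q j p → r + q * 9 + j * (9 * p) ≡ r + (q + j * p) * 9
  regroup = solve-∀
  holes : toℕ r ≡ 8 → word (tail a) (q + j * 9 ^ K) ≡ word (tail a) q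
  holes r≡8 = word-periodic K (tail a) q j
    (*-cancelʳ-< 9 (suc q) (9 ^ K) (subst₂ _<_ (cong (λ x → suc (x + q * 9)) r≡8) (*-comm 9 (9 ^ K)) 1+i<9^K+1))

UniformlyRecurrent : (ℕ → Bool) → Set
UniformlyRecurrent w =
  ∀ m → ∃ λ D → ∀ lo → ∃ λ q → lo ≤ q × q + m ≤ lo + D × (∀ j → j < m → w (q + j) ≡ w j)

n<9^n : ∀ n → n < 9 ^ n
n<9^n zero    = s≤s z≤n
n<9^n (suc n) =
  ≤-<-trans (n<9^n n) (subst (9 ^ n <_) (*-comm (9 ^ n) 9) (m<m*n (9 ^ n) 9 {{m^n≢0 9 n}} (s≤s (s≤s z≤n))))

-- The prefix of length m recurs at every multiple of 9 ^ m, as m < 9 ^ m.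
word-uniformlyRecurrent : ∀ a → UniformlyRecurrent (word a)
word-uniformlyRecurrent a m = 9 ^ m + m , λ lo → suc (lo / 9 ^ m) * 9 ^ m , lo≤q lo , q+m≤ lo , recurs lo
  where
  instance
    period-nonZero : NonZero (9 ^ m)
    period-nonZero = m^n≢0 9 m
  lo≤q : ∀ lo → lo ≤ suc (lo / 9 ^ m) * 9 ^ m
  lo≤q lo = <⇒≤ (subst (_< suc (lo / 9 ^ m) * 9 ^ m) (sym (m≡m%n+[m/n]*n lo (9 ^ m)))
                      (+-monoˡ-< (lo / 9 ^ m * 9 ^ m) (m%n<n lo (9 ^ m))))
  q+m≤ : ∀ lo → suc (lo / 9 ^ m) * 9 ^ m + m ≤ lo + (9 ^ m + m)
  q+m≤ lo = ≤-trans (+-monoˡ-≤ m (+-monoʳ-≤ (9 ^ m) (m/n*n≤m lo (9 ^ m))))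
                    (≤-reflexive (trans (cong (_+ m) (+-comm (9 ^ m) lo)) (+-assoc lo (9 ^ m) m)))
  recurs : ∀ lo j → j < m → word a (suc (lo / 9 ^ m) * 9 ^ m + j) ≡ word a j
  recurs lo j j<m =
    trans (cong (word a) (+-comm _ j)) (word-periodic m a j (suc (lo / 9 ^ m)) (≤-<-trans j<m (n<9^n m)))

-- Rigidity of the words

skeleton : ℕ → Maybe Bool
skeleton 2 = nothing
skeleton 8 = nothing
skeleton r = just (block false false r)

block-skeleton : ∀ {a₀ h} r {b} → skeleton r ≡ just b → block a₀ h r ≡ b
block-skeleton 0 refl = refl
block-skeleton 1 refl = refl
block-skeleton 3 refl = refl
block-skeleton 4 refl = refl
block-skeleton 5 refl = refl
block-skeleton 6 refl = refl
block-skeleton 7 refl = refl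
block-skeleton (suc (suc (suc (suc (suc (suc (suc (suc (suc _))))))))) refl = refl

word-skeleton : ∀ a x {b} → skeleton (x % 9) ≡ just b → word a x ≡ b
word-skeleton a x eq = trans (word-unfold a x) (block-skeleton (x % 9) eq)

Conflict : Maybe Bool → Maybe Bool → Set
Conflict (just u) (just v) = u ≢ v
Conflict _        _        = ⊥

conflict? : ∀ x y → Dec (Conflict x y)
conflict? (just u) (just v) = ¬? (u Bool.≟ v)
conflict? (just _) nothing  = no λ ()
conflict? nothing  _        = no λ ()

conflict⇒words-differ : ∀ a b x y → Conflict (skeleton (x % 9)) (skeleton (y % 9)) → word a x ≢ word b y
conflict⇒words-differ a b x y conflict with skeleton (x % 9) in sx | skeleton (y % 9) in sy
... | just u | just v = λ eq → conflict (trans (sym (word-skeleton a x sx)) (trans eq (word-skeleton b y sy)))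

-- Decided by inspecting the skeleton 0 0 · 0 1 0 1 1 · of the 9-blocks. In a mirrored copy, letter j
-- lands on residue p − j mod 9, written (p + (9 ∸ j)) % 9.
shift-conflict : ∀ {p} → p < 9 → 0 < p → ∃ λ j → j < 9 × Conflict (skeleton j) (skeleton ((p + j) % 9))
shift-conflict =
  from-yes (allUpTo? (λ p → 0 <? p →-dec anyUpTo? (λ j → conflict? (skeleton j) (skeleton ((p + j) % 9))) 9) 9)

mirror-conflict : ∀ {p} → p < 9 → ∃ λ j → j < 9 × Conflict (skeleton j) (skeleton ((p + (9 ∸ j)) % 9))
mirror-conflict =
  from-yes (allUpTo? (λ p → anyUpTo? (λ j → conflict? (skeleton j) (skeleton ((p + (9 ∸ j)) % 9))) 9) 9)

[m+n]%d≡[m%d+n]%d : ∀ m n d .{{_ : NonZero d}} → (m + n) % d ≡ (m % d + n) % d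
[m+n]%d≡[m%d+n]%d m n d = begin
  (m + n) % d                   ≡⟨ cong (λ x → (x + n) % d) (m≡m%n+[m/n]*n m d) ⟩
  (m % d + m / d * d + n) % d   ≡⟨ cong (_% d) (regroup (m % d) (m / d * d) n) ⟩
  (m % d + n + m / d * d) % d   ≡⟨ [m+kn]%n≡m%n (m % d + n) (m / d) d ⟩
  (m % d + n) % d               ∎
  where
  open ≡-Reasoning
  regroup : ∀ x y z → x + y + z ≡ x + z + y
  regroup = solve-∀

word-aligned : ∀ a b t → (∀ j → j < 9 → word a j ≡ word b (t + j)) → t ≡ t / 9 * 9
word-aligned a b t agree with t % 9 ≟ 0
... | yes aligned = trans (m≡m%n+[m/n]*n t 9) (cong (_+ t / 9 * 9) aligned)
... | no misaligned with shift-conflict (m%n<n t 9) (n≢0⇒n>0 misaligned)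
...   | j , j<9 , conflict = ⊥-elim (conflict⇒words-differ a b j (t + j)
          (subst₂ Conflict (cong skeleton (sym (m<n⇒m%n≡m j<9)))
                           (cong skeleton (sym ([m+n]%d≡[m%d+n]%d t j 9))) conflict)
          (agree j j<9))

word-unmirrored : ∀ a b c (g : ℕ → ℕ) → (∀ j → j < 9 → g j + j ≡ c) →
                  ¬ (∀ j → j < 9 → word a j ≡ word b (g j))
word-unmirrored a b c g mirror agree with mirror-conflict (m%n<n c 9)
... | j , j<9 , conflict = conflict⇒words-differ a b j (g j)
        (subst₂ Conflict (cong skeleton (sym (m<n⇒m%n≡m j<9))) (cong skeleton (sym residue)) conflict)
        (agree j j<9)
  where
  open ≡-Reasoning
  residue : g j % 9 ≡ (c % 9 + (9 ∸ j)) % 9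
  residue = begin
    g j % 9                  ≡⟨ [m+n]%n≡m%n (g j) 9 ⟨
    (g j + 9) % 9            ≡⟨ cong (λ x → (g j + x) % 9) (m+[n∸m]≡n (<⇒≤ j<9)) ⟨
    (g j + (j + (9 ∸ j))) % 9 ≡⟨ cong (_% 9) (sym (+-assoc (g j) j (9 ∸ j))) ⟩
    (g j + j + (9 ∸ j)) % 9  ≡⟨ cong (λ x → (x + (9 ∸ j)) % 9) (mirror j j<9) ⟩
    (c + (9 ∸ j)) % 9        ≡⟨ [m+n]%d≡[m%d+n]%d c (9 ∸ j) 9 ⟩
    (c % 9 + (9 ∸ j)) % 9    ∎

9≤9^1+n : ∀ n → 9 ≤ 9 ^ suc n
9≤9^1+n n = m≤m*n 9 (9 ^ n) {{m^n≢0 9 n}}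

-- Comparing the words on the holes reduces the question to the tails, one level down.
word-prefix-determines : ∀ n a b t → (∀ j → j < 9 ^ suc n → word a j ≡ word b (t + j)) → a n ≡ b n
word-prefix-determines zero a b t agree = begin
  word a 2                 ≡⟨ agree 2 (s≤s (s≤s (s≤s z≤n))) ⟩
  word b (t + 2)           ≡⟨ cong (word b) (trans (cong (_+ 2) (word-aligned a b t agree)) (+-comm (t / 9 * 9) 2)) ⟩
  word b (2 + t / 9 * 9)   ≡⟨ word-block b (t / 9) (s≤s (s≤s (s≤s z≤n))) ⟩
  b 0                      ∎
  where open ≡-Reasoning
word-prefix-determines (suc n) a b t agree =
  word-prefix-determines n (tail a) (tail b) (t / 9) λ j j<9^1+n → begin
  word (tail a) j                ≡⟨ word-block a j (n<1+n 8) ⟨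
  word a (8 + j * 9)             ≡⟨ agree (8 + j * 9) (hole< j<9^1+n) ⟩
  word b (t + (8 + j * 9))       ≡⟨ cong (λ x → word b (x + (8 + j * 9))) aligned ⟩
  word b (t / 9 * 9 + (8 + j * 9)) ≡⟨ cong (word b) (regroup (t / 9) j) ⟩
  word b (8 + (t / 9 + j) * 9)   ≡⟨ word-block b (t / 9 + j) (n<1+n 8) ⟩
  word (tail b) (t / 9 + j)      ∎
  where
  open ≡-Reasoning
  aligned : t ≡ t / 9 * 9
  aligned = word-aligned a b t (λ j j<9 → agree j (≤-trans j<9 (9≤9^1+n (suc n))))
  hole< : ∀ {j} → j < 9 ^ suc n → 8 + j * 9 < 9 ^ suc (suc n)
  hole< {j} j<9^1+n = ≤-trans (*-monoˡ-≤ 9 j<9^1+n) (≤-reflexive (*-comm (9 ^ suc n) 9))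
  regroup : ∀ k j → k * 9 + (8 + j * 9) ≡ 8 + (k + j) * 9
  regroup = solve-∀

-- Ages of decorated paths

PathAge : Kind → (ℕ → Bool) → Class
PathAge κ w G = Ambient κ G × ∃ λ n → Embedding G (path κ w n)

module _ {κ : Kind} {w : ℕ → Bool} where

  pathAge-hereditary : Hereditary (Ambient κ) (PathAge κ w)
  pathAge-hereditary = (λ G → proj₁) , λ G H ambientG (_ , n , H↪path) G↪H → ambientG , n , H↪path ∘ᴱ G↪H

  path∈pathAge : ∀ {n} → 4 ≤ n → PathAge κ w (path κ w n)
  path∈pathAge {n} 4≤n = path-ambient κ w n 4≤n , n , idEmbedding

  pathAge-infinite : InfiniteUpToIso (PathAge κ w)
  pathAge-infinite = unbounded⇒infinite λ B → path κ w (4 + B) , path∈pathAge (m≤m+n 4 B) , m<n+m B (s≤s z≤n)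

  -- The image of a large member is a long interval of the path; a later occurrence of the prefix
  -- of length m inside it pulls back to an embedding of the prefix path.
  pathAge-large⇒prefix : UniformlyRecurrent w → ∀ m → ∃ λ B → ∀ H → PathAge κ w H → B < size H →
                         Embedding (path κ w m) H
  pathAge-large⇒prefix recurrent m = 2 + D , containsPrefix
    where
    D : ℕ
    D = proj₁ (recurrent m)
    containsPrefix : ∀ H → PathAge κ w H → 2 + D < size H → Embedding (path κ w m) H
    containsPrefix H (ambient , n , e) 2+D<H = fromOccurrence (proj₂ (recurrent m) lo)
      where
      indecomposable : Indecomposable H
      indecomposable = ambient⇒indecomposable κ ambient
      3≤H : 3 ≤ size H
      3≤H = ≤-trans (m≤m+n 3 D) 2+D<H
      v₀ : Fin (size H)
      v₀ = fromℕ< (≤-trans (s≤s z≤n) 3≤H)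
      vmin vmax : Fin (size H)
      vmin = proj₁ (lowest (place e) v₀)
      vmax = proj₁ (highest (place e) v₀)
      lo hi : ℕ
      lo = place e vmin
      hi = place e vmax
      lo+D≤hi : lo + D ≤ hi
      lo+D≤hi = ≤-trans (+-monoʳ-≤ lo (≤-trans (m≤n+m D 2) (≤-pred (≤-trans 2+D<H span))))
                        (≤-reflexive (m+[n∸m]≡n (proj₂ (lowest (place e) v₀) vmax)))
        where
        span : size H ≤ suc (hi ∸ lo)
        span = injective⇒size≤range (place e) (λ eq → Embedding.injective e (toℕ-injective eq))
                                      (proj₂ (lowest (place e) v₀)) (proj₂ (highest (place e) v₀))
      fromOccurrence : (∃ λ q → lo ≤ q × q + m ≤ lo + D × (∀ j → j < m → w (q + j) ≡ w j)) →
                       Embedding (path κ w m) H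
      fromOccurrence (q , lo≤q , q+m≤lo+D , agree) = factorEmbedding e window lift
        where
        window : Embedding (path κ w m) (path κ w n)
        window = path-window {w' = w} q (≤-trans q+m≤lo+D (≤-trans lo+D≤hi (<⇒≤ (toℕ<n (Embedding.map e vmax)))))
                             agree
        lift : ∀ j → ∃ λ u → Embedding.map e u ≡ Embedding.map window j
        lift j = proj₁ hit , toℕ-injective (trans (proj₂ hit) (sym (toℕ-fromℕ< _)))
          where
          hit : ∃ λ u → place e u ≡ q + toℕ j
          hit = convexImage indecomposable (path-pathLike κ w n) e 3≤H {vmin} {vmax}
                  (≤-trans lo≤q (m≤m+n q (toℕ j)))
                  (≤-trans (<⇒≤ (+-monoʳ-< q (toℕ<n j))) (≤-trans q+m≤lo+D lo+D≤hi))

  pathAge-minimal : UniformlyRecurrent w → Minimal (Ambient κ) (PathAge κ w)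
  pathAge-minimal recurrent = pathAge-hereditary , pathAge-infinite , properSub⇒finite
    where
    properSub⇒finite : ∀ C → Hereditary (Ambient κ) C → ProperSub C (PathAge κ w) → FiniteUpToIso C
    properSub⇒finite C (_ , C-closed) (C⊆age , G , (ambientG , m , G↪path) , G∉C)
      with pathAge-large⇒prefix recurrent m
    ... | B , prefix = boundedSize⇒finite C B λ H CH →
      ≮⇒≥ λ B<H → G∉C (C-closed G H ambientG CH (prefix H (C⊆age H CH) B<H ∘ᴱ G↪path))

module _ (a b : ℕ → Bool) (n : ℕ) {N : ℕ} where
  private
    M : ℕ
    M = 9 ^ suc n
    1≤M : 1 ≤ M
    1≤M = ≤-trans (s≤s z≤n) (9≤9^1+n n)
    <9⇒≤M : ∀ {j} → j < 9 → j ≤ M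
    <9⇒≤M j<9 = ≤-trans (<⇒≤ j<9) (9≤9^1+n n)

  undirected-word-rigid : Embedding (path undirected (word a) (suc M)) (path undirected (word b) N) → a n ≡ b n
  undirected-word-rigid e = fromDirection (image-monotone 1≤M)
    where
    open EmbeddedPath (path-pathLike undirected (word a) (suc M)) (path-pathLike undirected (word b) N) e
    letters : ∀ j → j ≤ M → word a j ≡ word b (image j)
    letters = undirected-letters (word a) (word b) e
    fromDirection : Translation image M ⊎ Reflection image M → a n ≡ b n
    fromDirection (inj₁ forward)  = word-prefix-determines n a b (image 0) λ j j<M →
      trans (letters j (<⇒≤ j<M)) (cong (word b) (forward j (<⇒≤ j<M)))
    fromDirection (inj₂ backward) = ⊥-elim (word-unmirrored a b (image 0) image
      (λ j j<9 → backward j (<9⇒≤M j<9)) (λ j j<9 → letters j (<9⇒≤M j<9)))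

  directed-word-rigid : Embedding (path directed (word a) (suc M)) (path directed (word b) N) → a n ≡ b n
  directed-word-rigid e = fromDirection (image-monotone 1≤M)
    where
    open EmbeddedPath (path-pathLike directed (word a) (suc M)) (path-pathLike directed (word b) N) e
    fromDirection : Translation image M ⊎ Reflection image M → a n ≡ b n
    fromDirection (inj₁ forward)  = word-prefix-determines n a b (image 0) λ j j<M →
      trans (directed-letters (word a) (word b) e j j<M (translation⇒step forward j j<M))
            (cong (word b) (forward j (<⇒≤ j<M)))
    -- Every word starts with 0, so the back arc 1 → 0 is missing and the path cannot be reversed.
    fromDirection (inj₂ backward) =
      contradiction (directed-reversed⇒firstLetter (word a) (word b) e 1≤M
                       (trans (sym (backward 1 1≤M)) (+-comm (image 1) 1))) λ ()

word-path-rigid : ∀ κ n {a b N} → Embedding (path κ (word a) (suc (9 ^ suc n))) (path κ (word b) N) → a n ≡ b n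
word-path-rigid undirected n {a} {b} = undirected-word-rigid a b n
word-path-rigid directed   n {a} {b} = directed-word-rigid a b n

pathAge-injective : ∀ κ a b → SameClass (PathAge κ (word a)) (PathAge κ (word b)) → ∀ n → a n ≡ b n
pathAge-injective κ a b (age[a]⊆age[b] , _) n
  with age[a]⊆age[b] (path κ (word a) (suc (9 ^ suc n))) 
      (path∈pathAge {w = word a} (s≤s (≤-trans (m≤n+m 3 6) (9≤9^1+n n))))
... | _ , _ , e = word-path-rigid κ n {a} {b} e

continuumManyMinimal : ∀ κ → ContinuumManyMinimal (Ambient κ)
continuumManyMinimal κ =
  (λ a → PathAge κ (word a)) , (λ a → pathAge-minimal (word-uniformlyRecurrent a)) , pathAge-injective κ

theorem5p17 : ContinuumManyMinimal DirLooplessIndec × ContinuumManyMinimal UndirLoopsIndec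
theorem5p17 = continuumManyMinimal directed , continuumManyMinimal undirected
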